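{- During a delete-min in a slim or smooth heap, each node wins at most one left link and at most one right link.
   Context: In slim and smooth heaps, a delete-min deletes the root, making its children a list of roots, and then does leftmost locally maximum linking: find the leftmost three consecutive roots $u,v,w$ on the root list with $v.\mathit{key}\ge\max\{u.\mathit{key},w.\mathit{key}\}$ and link $v$ with whichever of $u,w$ has larger key (with $u$ if the keys of $u$ and $w$ are equal), where linking two roots makes the one of smaller key (the winner) the parent of the other (the loser), which leaves the root list while the winner keeps its position; repeat until one root remains. Special cases: this is done as if dummy roots with key $-\infty$ were at both ends of the list. A link is a left link if the loser is left of the winner on the root list just before the link, and a right link otherwise. -}

module Defs where

open import Data.Nat using (ℕ; zero; suc; _≤ᵇ_)
open import Data.Bool using (Bool; true; false; _∧_; if_then_else_)
open import Data.List using (List; []; _∷_; length; zip; upTo)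
open import Data.Maybe using (Maybe; just; nothing)
open import Data.Product using (_×_; _,_; proj₁; proj₂)

-- Names are the initial positions
-- of the roots on the root list (so they are pairwise distinct); keys are
-- natural numbers (any finite totally ordered key set embeds into ℕ
-- preserving order, ties included).
Root : Set
Root = ℕ × ℕ

name : Root → ℕ
name = proj₁

key : Root → ℕ
key = proj₂

data Dir : Set where
  leftLink rightLink : Dir

record Link : Set where
  constructor mkLink
  field
    winner : ℕ
    loser  : ℕ
    dir    : Dir
open Link public

-- Key of a possibly-dummy neighbour is ≤ k (the dummy has key -∞).
_≤?k_ : Maybe Root → ℕ → Bool
nothing ≤?k k = true
just u  ≤?k k = key u ≤ᵇ k

-- One leftmost-locally-maximum linking step.
-- `go l xs`: l is the root immediately left of the head of xs
-- (nothing = the left dummy with key -∞). Returns the performed link and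
-- the new version of xs (the loser removed; the winner keeps its position).
go : Maybe Root → List Root → Maybe (Link × List Root)
go l [] = nothing
go nothing (v ∷ []) = nothing
go (just u) (v ∷ []) =
  -- right neighbour is the dummy; v is a local max iff u.key ≤ v.key,
  -- and then v is linked with u (larger key than -∞): v loses, right link
  if key u ≤ᵇ key v then just (mkLink (name u) (name v) rightLink , []) else nothing
go l (v ∷ w ∷ rest) =
  if (l ≤?k key v) ∧ (key w ≤ᵇ key v)
    then just (linkWith l v w , w ∷ rest)
    else consRes v (go (just v) (w ∷ rest))
  where
  linkWith : Maybe Root → Root → Root → Link
  linkWith nothing  v w = mkLink (name w) (name v) leftLink
  linkWith (just u) v w =
    if key w ≤ᵇ key u then mkLink (name u) (name v) rightLink
                      else mkLink (name w) (name v) leftLink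
  consRes : Root → Maybe (Link × List Root) → Maybe (Link × List Root)
  consRes v nothing = nothing
  consRes v (just (lk , ys)) = just (lk , v ∷ ys)

step : List Root → Maybe (Link × List Root)
step = go nothing

-- Repeat linking steps (each removes one root; fuel = number of roots
-- suffices) and return the sequence of links performed.
run : ℕ → List Root → List Link
run zero xs = []
run (suc f) xs with step xs
... | nothing = []
... | just (lk , ys) = lk ∷ run f ys

-- The initial root list from the keys of the children of the deleted root,
-- left to right; the i-th root gets name i.
initRoots : List ℕ → List Root
initRoots ks = zip (upTo (length ks)) ks

deleteMinLinks : List ℕ → List Link
deleteMinLinks ks = run (length ks) (initRoots ks)

_≡ᵈ_ : Dir → Dir → Bool
leftLink  ≡ᵈ leftLink  = true
rightLink ≡ᵈ rightLink = true
_ ≡ᵈ _ = false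

wins : Dir → ℕ → List Link → ℕ
wins d a [] = zero
wins d a (lk ∷ lks) =
  if (winner lk Data.Nat.≡ᵇ a) ∧ (dir lk ≡ᵈ d) then suc (wins d a lks) else wins d a lks

-- A linking step scans the root list from the left while the keys strictly increase and stops
-- at the first local maximum, which loses. So a node that wins a left link is left with only
-- smaller keys to its left; as roots only ever disappear, nothing can again lose to it from the
-- left. A node that wins a right link ends the scanned increasing run and its new right neighbour
-- is no larger, so it is the leftmost local maximum and loses in the very next step.
module Submission where

open import Defs
open import Data.Nat using (ℕ; zero; suc; _≤_; _<_; _≤ᵇ_; _≡ᵇ_; _⊔_; z≤n; s≤s)
open import Data.Nat.Properties
  using ( ≤-refl; ≤-trans; ≤-reflexive; <⇒≤; <⇒≱; ≰⇒>; n≤1+n; m≤m⊔n; m≤n⊔m; ⊔-lub; ⊔-monoˡ-≤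
        ; ≤ᵇ-reflects-≤; ≡ᵇ⇒≡; ≡⇒≡ᵇ)
open import Data.Bool using (true; false; _∧_)
open import Data.Empty using (⊥-elim)
open import Data.Unit using (⊤; tt)
open import Data.List using (List; []; _∷_; _++_; map; zip; length; upTo; fromMaybe)
open import Data.List.Membership.Propositional using (_∈_; _∉_)
open import Data.List.Relation.Unary.All using ([]; _∷_)
open import Data.List.Relation.Unary.All.Properties using (All¬⇒¬Any)
open import Data.List.Relation.Unary.Any using (here; there)
open import Data.List.Relation.Unary.Unique.Propositional using (Unique; []; _∷_)
open import Data.List.Relation.Unary.Unique.Propositional.Properties
  using (upTo⁺; Unique[x∷xs]⇒x∉xs)
open import Data.List.Relation.Binary.Sublist.Propositional
  using (_⊆_; _⊇_; []; _∷_; _∷ʳ_; ⊆-refl; minimum; lookup)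
open import Data.List.Relation.Binary.Sublist.Propositional.Properties using (map⁺; All-resp-⊆)
open import Data.Maybe using (Maybe; just; nothing)
open import Data.Product using (_×_; _,_; proj₁)
open import Data.Sum using (_⊎_; inj₁; inj₂)
open import Function using (_∘_)
open import Relation.Binary.Definitions using (_Respects_)
open import Relation.Binary.PropositionalEquality using (_≡_; _≢_; refl; sym; trans; subst)
open import Relation.Nullary using (¬_)
open import Relation.Nullary.Reflects using (Reflects; ofʸ; ofⁿ; fromEquivalence; _×-reflects_)

private variable
  A B   : Set
  a b   : ℕ
  d     : Dir
  l     : Maybe Root
  xs ys : List Root
  lk    : Link

Unique-resp-⊇ : Unique {A = A} Respects _⊇_
Unique-resp-⊇ []           []        = []
Unique-resp-⊇ (_ ∷ʳ ys⊆)   (_ ∷ u)   = Unique-resp-⊇ ys⊆ u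
Unique-resp-⊇ (refl ∷ ys⊆) (x∉ ∷ u)  = All-resp-⊆ ys⊆ x∉ ∷ Unique-resp-⊇ ys⊆ u

map-proj₁-zip-⊆ : (xs : List A) (ys : List B) → map proj₁ (zip xs ys) ⊆ xs
map-proj₁-zip-⊆ []       _        = []
map-proj₁-zip-⊆ (_ ∷ _)  []       = minimum _
map-proj₁-zip-⊆ (_ ∷ xs) (_ ∷ ys) = refl ∷ map-proj₁-zip-⊆ xs ys

names : List Root → List ℕ
names = map name

Distinct : List Root → Set
Distinct xs = Unique (names xs)

initRoots-distinct : ∀ ks → Distinct (initRoots ks)
initRoots-distinct ks = Unique-resp-⊇ (map-proj₁-zip-⊆ (upTo (length ks)) ks) (upTo⁺ (length ks))

-- `sucKey l ≤ k` says that l has a key below k; the dummy root (key −∞) is below every key.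
sucKey : Maybe Root → ℕ
sucKey nothing  = 0
sucKey (just u) = suc (key u)

StartsAbove : Maybe Root → List Root → Set
StartsAbove l []      = ⊤
StartsAbove l (v ∷ _) = sucKey l ≤ key v

-- The runs of `go l xs` along a strictly increasing prefix, performing link lk and leaving ys.
data Step : Maybe Root → List Root → Link → List Root → Set where
  lastRight : ∀ {u v} → key u ≤ key v →
              Step (just u) (v ∷ []) (mkLink (name u) (name v) rightLink) []
  firstLeft : ∀ {v w rest} → key w ≤ key v →
              Step nothing (v ∷ w ∷ rest) (mkLink (name w) (name v) leftLink) (w ∷ rest)
  linkRight : ∀ {u v w rest} → key u ≤ key v → key w ≤ key u →
              Step (just u) (v ∷ w ∷ rest) (mkLink (name u) (name v) rightLink) (w ∷ rest)
  linkLeft  : ∀ {u v w rest} → key u < key w → key w ≤ key v →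
              Step (just u) (v ∷ w ∷ rest) (mkLink (name w) (name v) leftLink) (w ∷ rest)
  skip      : ∀ {l v w rest lk ys} → sucKey l ≤ key v → key v < key w →
              Step (just v) (w ∷ rest) lk ys → Step l (v ∷ w ∷ rest) lk (v ∷ ys)

go-Step : ∀ l xs → StartsAbove l xs → go l xs ≡ just (lk , ys) → Step l xs lk ys
go-Step l        []             _   ()
go-Step nothing  (v ∷ [])       _   ()
go-Step (just u) (v ∷ [])       _   eq with key u ≤ᵇ key v | ≤ᵇ-reflects-≤ (key u) (key v)
... | true  | ofʸ u≤v with refl ← eq = lastRight u≤v
go-Step (just u) (v ∷ [])       _   () | false | _
go-Step nothing  (v ∷ w ∷ rest) _   eq with key w ≤ᵇ key v | ≤ᵇ-reflects-≤ (key w) (key v)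
... | true  | ofʸ w≤v with refl ← eq = firstLeft w≤v
... | false | ofⁿ w≰v with go (just v) (w ∷ rest) in g | eq
...   | just _ | refl = skip z≤n (≰⇒> w≰v) (go-Step (just v) (w ∷ rest) (≰⇒> w≰v) g)
go-Step (just u) (v ∷ w ∷ rest) u<v eq with key u ≤ᵇ key v | ≤ᵇ-reflects-≤ (key u) (key v)
... | false | ofⁿ u≰v = ⊥-elim (u≰v (<⇒≤ u<v))
... | true  | ofʸ u≤v with key w ≤ᵇ key v | ≤ᵇ-reflects-≤ (key w) (key v)
...   | false | ofⁿ w≰v with go (just v) (w ∷ rest) in g | eq
...     | just _ | refl = skip u<v (≰⇒> w≰v) (go-Step (just v) (w ∷ rest) (≰⇒> w≰v) g)
go-Step (just u) (v ∷ w ∷ rest) u<v eq | true | ofʸ u≤v | true | ofʸ w≤v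
  with key w ≤ᵇ key u | ≤ᵇ-reflects-≤ (key w) (key u)
... | true  | ofʸ w≤u with refl ← eq = linkRight u≤v w≤u
... | false | ofⁿ w≰u with refl ← eq = linkLeft (≰⇒> w≰u) w≤v

step-Step : ∀ xs → step xs ≡ just (lk , ys) → Step nothing xs lk ys
step-Step []      = go-Step nothing [] tt
step-Step (_ ∷ _) = go-Step nothing (_ ∷ _) z≤n

Step-⊆ : Step l xs lk ys → ys ⊆ xs
Step-⊆ (lastRight _)   = _ ∷ʳ []
Step-⊆ (firstLeft _)   = _ ∷ʳ ⊆-refl
Step-⊆ (linkRight _ _) = _ ∷ʳ ⊆-refl
Step-⊆ (linkLeft _ _)  = _ ∷ʳ ⊆-refl
Step-⊆ (skip _ _ s)    = refl ∷ Step-⊆ s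

Step-winner∈ : Step l xs lk ys → winner lk ∈ names (fromMaybe l ++ xs)
Step-winner∈ (lastRight _)              = here refl
Step-winner∈ (firstLeft _)              = there (here refl)
Step-winner∈ (linkRight _ _)            = here refl
Step-winner∈ (linkLeft _ _)             = there (there (here refl))
Step-winner∈ (skip {l = nothing} _ _ s) = Step-winner∈ s
Step-winner∈ (skip {l = just _}  _ _ s) = there (Step-winner∈ s)

Step-loser∈ : Step l xs lk ys → loser lk ∈ names xs
Step-loser∈ (lastRight _)   = here refl
Step-loser∈ (firstLeft _)   = here refl
Step-loser∈ (linkRight _ _) = here refl
Step-loser∈ (linkLeft _ _)  = here refl
Step-loser∈ (skip _ _ s)    = there (Step-loser∈ s)

Step-winner≢loser : Distinct (fromMaybe l ++ xs) → Step l xs lk ys → winner lk ≢ loser lk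
Step-winner≢loser ((u≢v ∷ _) ∷ _)     (lastRight _)              = u≢v
Step-winner≢loser ((v≢w ∷ _) ∷ _)     (firstLeft _)              = v≢w ∘ sym
Step-winner≢loser ((u≢v ∷ _) ∷ _)     (linkRight _ _)            = u≢v
Step-winner≢loser (_ ∷ (v≢w ∷ _) ∷ _) (linkLeft _ _)             = v≢w ∘ sym
Step-winner≢loser distinct            (skip {l = nothing} _ _ s) = Step-winner≢loser distinct s
Step-winner≢loser (_ ∷ distinct)      (skip {l = just _}  _ _ s) = Step-winner≢loser distinct s

Step-loser∉ : Distinct xs → Step l xs lk ys → loser lk ∉ names ys
Step-loser∉ _               (lastRight _)   ()
Step-loser∉ distinct        (firstLeft _)   = Unique[x∷xs]⇒x∉xs distinct
Step-loser∉ distinct        (linkRight _ _) = Unique[x∷xs]⇒x∉xs distinct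
Step-loser∉ distinct        (linkLeft _ _)  = Unique[x∷xs]⇒x∉xs distinct
Step-loser∉ (v∉ ∷ _)        (skip _ _ s)    (here loser≡v) =
  All¬⇒¬Any v∉ (subst (_∈ _) loser≡v (Step-loser∈ s))
Step-loser∉ (_ ∷ distinct)  (skip _ _ s)    (there loser∈) = Step-loser∉ distinct s loser∈

Wins : Dir → ℕ → Link → Set
Wins d a lk = winner lk ≡ a × dir lk ≡ d

-- Every root named a has key at least b and larger than all keys to its left.
KeyAboveLeft : ℕ → ℕ → List Root → Set
KeyAboveLeft a b []       = ⊤
KeyAboveLeft a b (x ∷ xs) = (name x ≡ a → b ≤ key x) × KeyAboveLeft a (b ⊔ suc (key x)) xs

KeyAboveLeft-antitone : ∀ {b′} xs → b ≤ b′ → KeyAboveLeft a b′ xs → KeyAboveLeft a b xs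
KeyAboveLeft-antitone []       _    _                = tt
KeyAboveLeft-antitone (_ ∷ xs) b≤b′ (above , aboveᵣ) =
  ≤-trans b≤b′ ∘ above , KeyAboveLeft-antitone xs (⊔-monoˡ-≤ _ b≤b′) aboveᵣ

KeyAboveLeft-⊆ : ys ⊆ xs → KeyAboveLeft a b xs → KeyAboveLeft a b ys
KeyAboveLeft-⊆ []           _                = tt
KeyAboveLeft-⊆ (_ ∷ʳ ys⊆)   (_ , aboveᵣ)     =
  KeyAboveLeft-⊆ ys⊆ (KeyAboveLeft-antitone _ (m≤m⊔n _ _) aboveᵣ)
KeyAboveLeft-⊆ (refl ∷ ys⊆) (above , aboveᵣ) = above , KeyAboveLeft-⊆ ys⊆ aboveᵣ

KeyAboveLeft-∉ : ∀ xs → a ∉ names xs → KeyAboveLeft a b xs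
KeyAboveLeft-∉ []       _  = tt
KeyAboveLeft-∉ (_ ∷ xs) a∉ = (λ x≡a → ⊥-elim (a∉ (here (sym x≡a)))) , KeyAboveLeft-∉ xs (a∉ ∘ there)

KeyAboveLeft⇒¬leftWin : KeyAboveLeft a b xs → Step l xs lk ys → ¬ Wins leftLink a lk
KeyAboveLeft⇒¬leftWin _               (lastRight _)    (_ , ())
KeyAboveLeft⇒¬leftWin _               (linkRight _ _)  (_ , ())
KeyAboveLeft⇒¬leftWin (_ , above , _) (firstLeft w≤v)  (w≡a , _) =
  <⇒≱ (≤-trans (m≤n⊔m _ _) (above w≡a)) w≤v
KeyAboveLeft⇒¬leftWin (_ , above , _) (linkLeft _ w≤v) (w≡a , _) =
  <⇒≱ (≤-trans (m≤n⊔m _ _) (above w≡a)) w≤v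
KeyAboveLeft⇒¬leftWin (_ , aboveᵣ)    (skip _ _ s)     = KeyAboveLeft⇒¬leftWin aboveᵣ s

leftWin⇒KeyAboveLeft : Distinct xs → Step l xs lk ys → Wins leftLink a lk → b ≤ sucKey l →
                       KeyAboveLeft a b ys
leftWin⇒KeyAboveLeft _              (lastRight _)    (_ , ())
leftWin⇒KeyAboveLeft _              (linkRight _ _)  (_ , ())
leftWin⇒KeyAboveLeft (_ ∷ distinct) (firstLeft _)    (refl , _) b≤0 =
  (λ _ → ≤-trans b≤0 z≤n) , KeyAboveLeft-∉ _ (Unique[x∷xs]⇒x∉xs distinct)
leftWin⇒KeyAboveLeft (_ ∷ distinct) (linkLeft u<w _) (refl , _) b≤u =
  (λ _ → ≤-trans b≤u u<w) , KeyAboveLeft-∉ _ (Unique[x∷xs]⇒x∉xs distinct)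
leftWin⇒KeyAboveLeft {b = b} (_ ∷ distinct) (skip {v = v} l<v _ s) won b≤l =
  (λ _ → b≤v) , leftWin⇒KeyAboveLeft distinct s won (⊔-lub (≤-trans b≤v (n≤1+n _)) ≤-refl)
  where
  b≤v : b ≤ key v
  b≤v = ≤-trans b≤l l<v

-- The root named a is the leftmost local maximum.
data RisesToPeak (a : ℕ) : List Root → Set where
  lastPeak : ∀ {x} → name x ≡ a → RisesToPeak a (x ∷ [])
  peak     : ∀ {x y xs} → name x ≡ a → key y ≤ key x → RisesToPeak a (x ∷ y ∷ xs)
  rise     : ∀ {x y xs} → key x < key y → RisesToPeak a (y ∷ xs) → RisesToPeak a (x ∷ y ∷ xs)

rightWin⇒RisesToPeak : Step l xs lk ys → Wins rightLink a lk → RisesToPeak a (fromMaybe l ++ ys)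
rightWin⇒RisesToPeak (lastRight _)               (u≡a , _) = lastPeak u≡a
rightWin⇒RisesToPeak (linkRight _ w≤u)           (u≡a , _) = peak u≡a w≤u
rightWin⇒RisesToPeak (firstLeft _)               (_ , ())
rightWin⇒RisesToPeak (linkLeft _ _)              (_ , ())
rightWin⇒RisesToPeak (skip {l = nothing} _ _ s)  won       = rightWin⇒RisesToPeak s won
rightWin⇒RisesToPeak (skip {l = just _} u<v _ s) won       = rise u<v (rightWin⇒RisesToPeak s won)

RisesToPeak⇒loser≡ : RisesToPeak a xs → Step l xs lk ys → loser lk ≡ a
RisesToPeak⇒loser≡ (lastPeak v≡a) (lastRight _)       = v≡a
RisesToPeak⇒loser≡ (peak v≡a _)   (firstLeft _)       = v≡a
RisesToPeak⇒loser≡ (peak v≡a _)   (linkRight _ _)     = v≡a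
RisesToPeak⇒loser≡ (peak v≡a _)   (linkLeft _ _)      = v≡a
RisesToPeak⇒loser≡ (peak _ w≤v)   (skip _ v<w _)      = ⊥-elim (<⇒≱ v<w w≤v)
RisesToPeak⇒loser≡ (rise v<w _)   (firstLeft w≤v)     = ⊥-elim (<⇒≱ v<w w≤v)
RisesToPeak⇒loser≡ (rise v<w _)   (linkRight u≤v w≤u) = ⊥-elim (<⇒≱ v<w (≤-trans w≤u u≤v))
RisesToPeak⇒loser≡ (rise v<w _)   (linkLeft _ w≤v)    = ⊥-elim (<⇒≱ v<w w≤v)
RisesToPeak⇒loser≡ (rise _ r)     (skip _ _ s)        = RisesToPeak⇒loser≡ r s

≡ᵈ-reflects : ∀ d d′ → Reflects (d ≡ d′) (d ≡ᵈ d′)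
≡ᵈ-reflects leftLink  leftLink  = ofʸ refl
≡ᵈ-reflects leftLink  rightLink = ofⁿ λ ()
≡ᵈ-reflects rightLink leftLink  = ofⁿ λ ()
≡ᵈ-reflects rightLink rightLink = ofʸ refl

Wins-reflects : ∀ d a lk → Reflects (Wins d a lk) ((winner lk ≡ᵇ a) ∧ (dir lk ≡ᵈ d))
Wins-reflects d a lk =
  fromEquivalence (≡ᵇ⇒≡ (winner lk) a) (≡⇒≡ᵇ (winner lk) a) ×-reflects ≡ᵈ-reflects (dir lk) d

Invariant : (List Root → Set) → Set
Invariant P = ∀ {xs lk ys} → Step nothing xs lk ys → P xs → P ys

NeverWins : Dir → ℕ → (List Root → Set) → Set
NeverWins d a P = ∀ {xs lk ys} → Step nothing xs lk ys → P xs → ¬ Wins d a lk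

Distinct-invariant : Invariant Distinct
Distinct-invariant s = Unique-resp-⊇ (map⁺ name (Step-⊆ s))

∉-invariant : ∀ a → Invariant (λ xs → a ∉ names xs)
∉-invariant a s a∉ = a∉ ∘ lookup (map⁺ name (Step-⊆ s))

run-wins≡0 : (P : List Root → Set) → Invariant P → NeverWins d a P →
             ∀ f xs → P xs → wins d a (run f xs) ≡ 0
run-wins≡0 P invariant never zero    xs p = refl
run-wins≡0 {d} {a} P invariant never (suc f) xs p with step xs in eq
... | nothing        = refl
... | just (lk , ys) with (winner lk ≡ᵇ a) ∧ (dir lk ≡ᵈ d) | Wins-reflects d a lk
...   | true  | ofʸ won = ⊥-elim (never (step-Step xs eq) p won)
...   | false | ofⁿ _   = run-wins≡0 P invariant never f ys (invariant (step-Step xs eq) p)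

run-wins≤1 : (P : List Root → Set) → Invariant P → NeverWins d a P →
             (∀ {xs lk ys} → Step nothing xs lk ys → Distinct xs → Wins d a lk → P ys) →
             ∀ f xs → Distinct xs → wins d a (run f xs) ≤ 1
run-wins≤1 P invariant never after zero    xs distinct = z≤n
run-wins≤1 {d} {a} P invariant never after (suc f) xs distinct with step xs in eq
... | nothing        = z≤n
... | just (lk , ys) with (winner lk ≡ᵇ a) ∧ (dir lk ≡ᵈ d) | Wins-reflects d a lk
...   | true  | ofʸ won =
  s≤s (≤-reflexive (run-wins≡0 P invariant never f ys (after (step-Step xs eq) distinct won)))
...   | false | ofⁿ _   =
  run-wins≤1 P invariant never after f ys (Distinct-invariant (step-Step xs eq) distinct)

leftWins≤1 : ∀ a f xs → Distinct xs → wins leftLink a (run f xs) ≤ 1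
leftWins≤1 a = run-wins≤1 (KeyAboveLeft a 0) (KeyAboveLeft-⊆ ∘ Step-⊆)
  (λ s above → KeyAboveLeft⇒¬leftWin above s)
  (λ s distinct won → leftWin⇒KeyAboveLeft distinct s won z≤n)

rightWins≤1 : ∀ a f xs → Distinct xs → wins rightLink a (run f xs) ≤ 1
rightWins≤1 a = run-wins≤1 AbsentOrPeak invariant never after
  where
  AbsentOrPeak : List Root → Set
  AbsentOrPeak xs = Distinct xs × (a ∉ names xs ⊎ RisesToPeak a xs)

  invariant : Invariant AbsentOrPeak
  invariant s (distinct , inj₁ a∉) = Distinct-invariant s distinct , inj₁ (∉-invariant a s a∉)
  invariant {ys = ys} s (distinct , inj₂ r) = Distinct-invariant s distinct , inj₁ a∉
    where
    a∉ : a ∉ names ys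
    a∉ = subst (_∉ names ys) (RisesToPeak⇒loser≡ r s) (Step-loser∉ distinct s)

  never : NeverWins rightLink a AbsentOrPeak
  never s (_ , inj₁ a∉)       (w≡a , _) = a∉ (subst (_∈ _) w≡a (Step-winner∈ s))
  never s (distinct , inj₂ r) (w≡a , _) =
    Step-winner≢loser distinct s (trans w≡a (sym (RisesToPeak⇒loser≡ r s)))

  after : ∀ {xs lk ys} → Step nothing xs lk ys → Distinct xs → Wins rightLink a lk → AbsentOrPeak ys
  after s distinct won = Distinct-invariant s distinct , inj₂ (rightWin⇒RisesToPeak s won)

lemma3p2 : (ks : List ℕ) (a : ℕ) →
    (wins leftLink a (deleteMinLinks ks) ≤ 1) × (wins rightLink a (deleteMinLinks ks) ≤ 1)
lemma3p2 ks a = leftWins≤1 a (length ks) (initRoots ks) (initRoots-distinct ks)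
              , rightWins≤1 a (length ks) (initRoots ks) (initRoots-distinct ks)
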